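{- Let $P \subsetneq Q \subseteq D_1^{r_1}$ and $R \subsetneq S \subseteq D_2^{r_2}$ be predicates, let $\mathcal I = (I_1, \dots, I_{r_2})$ be a sequence of subsets of $[r_1]$, and suppose $P \mid Q$ is an $\mathcal I$-substructure of $R \mid S$ with witnessing maps $g_1, \dots, g_{r_2}$. If $H = (V_1, \dots, V_{r_1}, E)$ is an $r_1$-partite non-redundant instance of $\operatorname{CSP}(P \mid Q)$, then the projection hypergraph $\operatorname{pr}_{\mathcal I} H$ is a non-redundant instance of $\operatorname{CSP}(R \mid S)$.
   Context: An instance is a hypergraph $H=(V,E)$ with $E\subseteq V^r$ (ordered tuples); $H=(V_1,\dots,V_r,E)$ is $r$-partite if $V=V_1\sqcup\dots\sqcup V_r$ and $E \subseteq V_1\times\dots\times V_r$. For $P \subsetneq Q \subseteq D^r$, $H$ is a non-redundant instance of $\operatorname{CSP}(P\mid Q)$ if for every $e\in E$ there is $\psi_e : V\to D$ with $\psi_e(e')\in P$ for all $e'\neq e$ and $\psi_e(e)\in Q\setminus P$ (coordinatewise). For $I\subseteq[r]$, $\pi_I x = (x_i : i\in I)$ and $\pi_I E = \{\pi_I e : e \in E\}$. $P\mid Q$ is an $\mathcal I$-substructure of $R\mid S$ with witnessing maps $g_j : D_1^{I_j}\to D_2$ if $(g_1(\pi_{I_1}x),\dots,g_{r_2}(\pi_{I_{r_2}}x))\in R$ for all $x\in P$ and $\in S\setminus R$ for all $x \in Q\setminus P$. The projection hypergraph $\operatorname{pr}_{\mathcal I} H$ is the $r_2$-partite hypergraph whose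 $j$-th part is (a disjoint copy of) $\pi_{I_j} E$ and whose edge set is $\{(\pi_{I_1}e,\dots,\pi_{I_{r_2}}e) : e \in E\}$. -}

module Defs where

open import Data.Nat using (ℕ; zero; suc)
open import Data.Fin using (Fin)
open import Data.Bool using (Bool; true; false)
open import Data.Vec using (Vec; []; _∷_; map; tabulate)
open import Data.Fin.Subset using (Subset)
open import Data.Product using (Σ; ∃; _×_; _,_)
open import Relation.Binary.PropositionalEquality using (_≡_; _≢_)
open import Relation.Nullary using (¬_)

Pred : Set → ℕ → Set₁
Pred D r = Vec D r → Set

_⊊_ : ∀ {D r} → Pred D r → Pred D r → Set
P ⊊ Q = (∀ x → P x → Q x) × ∃ λ x → Q x × ¬ P x

size : ∀ {n} → Subset n → ℕ
size [] = zero
size (true ∷ I) = suc (size I)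
size (false ∷ I) = size I

-- π_I x = (x_i : i ∈ I), listed in increasing order of i; D^I = Vec D (size I)
proj : ∀ {A : Set} {n} (I : Subset n) → Vec A n → Vec A (size I)
proj [] [] = []
proj (true ∷ I) (x ∷ xs) = x ∷ proj I xs
proj (false ∷ I) (x ∷ xs) = proj I xs

record Hypergraph (r : ℕ) : Set₁ where
  field
    V : Set
    E : Vec V r → Set
open Hypergraph public

IsPartite : ∀ {r} → Hypergraph r → Set
IsPartite {r} H =
  Σ (V H → Fin r) λ part →
    ∀ e → E H e → ∀ i → part (Data.Vec.lookup e i) ≡ i

NonRedundant : ∀ {D : Set} {r} → Pred D r → Pred D r → Hypergraph r → Set
NonRedundant {D} P Q H =
  ∀ e → E H e →
    Σ (V H → D) λ ψ →
      (∀ e′ → E H e′ → e′ ≢ e → P (map ψ e′))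
      × Q (map ψ e) × ¬ P (map ψ e)

IsSubstructure : ∀ {D₁ D₂ : Set} {r₁ r₂} →
  (P Q : Pred D₁ r₁) (R S : Pred D₂ r₂) (I : Fin r₂ → Subset r₁) →
  ((j : Fin r₂) → Vec D₁ (size (I j)) → D₂) → Set
IsSubstructure P Q R S I g =
  (∀ x → P x → R (tabulate λ j → g j (proj (I j) x)))
  × (∀ x → Q x → ¬ P x →
       S (tabulate λ j → g j (proj (I j) x)) × ¬ R (tabulate λ j → g j (proj (I j) x)))

-- The j-th part consists of pairs (j , y) with
-- y ∈ D^{I_j}-shaped tuples of vertices (a disjoint copy, tagged by j); the edges are
-- (π_{I_1} e, ..., π_{I_{r₂}} e) for e ∈ E.
PrVertex : ∀ {r₁ r₂} (V : Set) (I : Fin r₂ → Subset r₁) → Set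
PrVertex {r₂ = r₂} V I = Σ (Fin r₂) λ j → Vec V (size (I j))

prEdge : ∀ {r₁ r₂} {V : Set} (I : Fin r₂ → Subset r₁) → Vec V r₁ → Vec (PrVertex V I) r₂
prEdge I e = tabulate λ j → (j , proj (I j) e)

pr : ∀ {r₁ r₂} (I : Fin r₂ → Subset r₁) → Hypergraph r₁ → Hypergraph r₂
pr I H = record
  { V = PrVertex (V H) I
  ; E = λ f → ∃ λ e → E H e × prEdge I e ≡ f
  }

{-# OPTIONS --safe #-}
module Submission where

-- A non-redundancy witness ψ_e for an edge e of H induces one for the projected edge
-- pr_I e: send the vertex π_{I_j} e' of the j-th part to g_j (ψ_e ∘ π_{I_j} e').  This
-- assignment maps pr_I e' to the image of ψ_e(e') under the witnessing maps, which lies in R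
-- when ψ_e(e') ∈ P and in S ∖ R when ψ_e(e') ∈ Q ∖ P; and distinct projected edges
-- come from distinct edges of H.

open import Defs
open import Data.Nat using (ℕ)
open import Data.Fin using (Fin)
open import Data.Vec using (Vec; []; _∷_; map; tabulate)
open import Data.Vec.Properties using (tabulate-∘; tabulate-cong)
open import Data.Fin.Subset using (Subset)
open import Data.Bool using (true; false)
open import Data.Product using (_,_)
open import Function using (_∘_)
open import Relation.Binary.PropositionalEquality using (_≡_; _≢_; refl; sym; cong; subst; module ≡-Reasoning)
open import Relation.Nullary using (¬_)

proj-map : ∀ {A B : Set} {n} (f : A → B) (I : Subset n) (x : Vec A n) →
  proj I (map f x) ≡ map f (proj I x)
proj-map f []          []       = refl
proj-map f (true ∷ I)  (x ∷ xs) = cong (f x ∷_) (proj-map f I xs)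
proj-map f (false ∷ I) (x ∷ xs) = proj-map f I xs

module _ {D₁ D₂ : Set} {r₁ r₂ : ℕ} (I : Fin r₂ → Subset r₁)
         (g : (j : Fin r₂) → Vec D₁ (size (I j)) → D₂) where

  witnessImage : Vec D₁ r₁ → Vec D₂ r₂
  witnessImage x = tabulate λ j → g j (proj (I j) x)

  module _ {V : Set} where

    prAssignment : (V → D₁) → PrVertex V I → D₂
    prAssignment ψ (j , y) = g j (map ψ y)

    map-prAssignment-prEdge : (ψ : V → D₁) (e : Vec V r₁) →
      map (prAssignment ψ) (prEdge I e) ≡ witnessImage (map ψ e)
    map-prAssignment-prEdge ψ e = begin
      map (prAssignment ψ) (tabulate λ j → (j , proj (I j) e))
        ≡⟨ sym (tabulate-∘ (prAssignment ψ) (λ j → (j , proj (I j) e))) ⟩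
      tabulate (λ j → g j (map ψ (proj (I j) e)))
        ≡⟨ tabulate-cong (λ j → cong (g j) (sym (proj-map ψ (I j) e))) ⟩
      witnessImage (map ψ e) ∎
      where open ≡-Reasoning

nonRedundant-pr : ∀ {D₁ D₂ : Set} {r₁ r₂}
  (P Q : Pred D₁ r₁) (R S : Pred D₂ r₂)
  (I : Fin r₂ → Subset r₁) (g : (j : Fin r₂) → Vec D₁ (size (I j)) → D₂) →
  IsSubstructure P Q R S I g →
  (H : Hypergraph r₁) → NonRedundant P Q H → NonRedundant R S (pr I H)
nonRedundant-pr P Q R S I g (P⇒R , Q∖P⇒S∖R) H nonRed .(prEdge I e) (e , e∈E , refl)
  with nonRed e e∈E
... | ψ , othersInP , Qψe , ¬Pψe with Q∖P⇒S∖R (map ψ e) Qψe ¬Pψe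
... | Sψe , ¬Rψe =
  prAssignment I g ψ , othersInR , subst S image≡ Sψe , subst (¬_ ∘ R) image≡ ¬Rψe
  where
  image≡ : witnessImage I g (map ψ e) ≡ map (prAssignment I g ψ) (prEdge I e)
  image≡ = sym (map-prAssignment-prEdge I g ψ e)

  othersInR : ∀ f → E (pr I H) f → f ≢ prEdge I e → R (map (prAssignment I g ψ) f)
  othersInR .(prEdge I e′) (e′ , e′∈E , refl) pr-e′≢pr-e =
    subst R (sym (map-prAssignment-prEdge I g ψ e′))
      (P⇒R (map ψ e′) (othersInP e′ e′∈E (pr-e′≢pr-e ∘ cong (prEdge I))))

lemma3p3 : {D₁ D₂ : Set} {r₁ r₂ : ℕ}
    (P Q : Pred D₁ r₁) (R S : Pred D₂ r₂) →
    P ⊊ Q → R ⊊ S →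
    (I : Fin r₂ → Subset r₁) (g : (j : Fin r₂) → Vec D₁ (size (I j)) → D₂) →
    IsSubstructure P Q R S I g →
    (H : Hypergraph r₁) → IsPartite H → NonRedundant P Q H →
    NonRedundant R S (pr I H)
lemma3p3 P Q R S _ _ I g substructure H _ = nonRedundant-pr P Q R S I g substructure H
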